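{- Let $P$ be an ordered set of width $w\ge3$ such that no $p\in P$ is a common fixed point of all automorphisms of $P$, such that there is a $j$ with $|R_j|=w-1$ and $\alpha(R_j)=(w-1)!$, and such that the set $\{x\in P:\mathrm{rank}(x)\ge j+1\}$ is nonempty and not order-autonomous. Then $R_j\cup R_{j+1}$ is isomorphic to $S_{w-1}$ or to $(w-1)C_2$, and consequently $\alpha(R_{j+1})=(w-1)!$.
   Context: Ordered sets are finite; width = largest antichain size. Rank: minimal elements have rank $0$; $x$ has rank $k$ iff $x$ is minimal in $P\setminus\{z:\mathrm{rank}(z)\le k-1\}$; $R_k$ is the set of elements of rank $k$; $\alpha(R_k)$ is the number of distinct restrictions $\Phi|_{R_k}$ with $\Phi\in\mathrm{Aut}(P)$. A nonempty $A\subseteq P$ is order-autonomous iff for all $z\in P\setminus A$: $z<a$ for some $a\in A$ implies $z<a'$ for all $a'\in A$, and $z>a$ for some $a\in A$ implies $z>a'$ for all $a'\in A$. $S_k$ (standard example) has minimal elements $\ell_1,\dots,\ell_k$, maximal elements $u_1,\dots,u_k$, and $\ell_i<u_j$ iff $i\ne j$ (the paper introduces this for $k\ge3$; for $k=2$ the same description applies). $kC_2$ is the disjoint union of $k$ two-element chains. -}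

module Defs where

open import Level using (0ℓ)
open import Data.Nat using (ℕ; zero; suc; _≤_; _!)
open import Data.Fin using (Fin)
open import Data.List using (List; length)
open import Data.List.Membership.Propositional using (_∈_)
open import Data.List.Relation.Unary.Unique.Propositional using (Unique)
open import Data.List.Relation.Unary.AllPairs using (AllPairs)
open import Data.Product using (Σ; ∃; ∃-syntax; _×_; _,_)
open import Data.Sum using (_⊎_)
open import Data.Empty using (⊥)
open import Relation.Nullary using (¬_; Dec)
open import Relation.Binary.PropositionalEquality using (_≡_; _≢_)
open import Function.Bundles using (_⇔_)
open import Function.Definitions using (Injective)

-- A finite ordered set: carrier Fin n, strict order _<_ (irreflexive, transitive).
-- Decidability of _<_ is included (automatic classically for finite sets).
record FinPoset : Set₁ where
  field
    n      : ℕ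
    _<_    : Fin n → Fin n → Set
    irrefl : ∀ x → ¬ (x < x)
    trans  : ∀ {x y z} → x < y → y < z → x < z
    dec    : ∀ x y → Dec (x < y)

module _ (P : FinPoset) where
  open FinPoset P

  Antichain : List (Fin n) → Set
  Antichain = AllPairs (λ x y → x ≢ y × ¬ (x < y) × ¬ (y < x))

  Width : ℕ → Set
  Width w = (Σ (List (Fin n)) λ xs → Antichain xs × length xs ≡ w)
          × (∀ xs → Antichain xs → length xs ≤ w)

  record Aut : Set where
    field
      fun   : Fin n → Fin n
      inv   : Fin n → Fin n
      invˡ  : ∀ x → inv (fun x) ≡ x
      invʳ  : ∀ x → fun (inv x) ≡ x
      order : ∀ x y → (x < y) ⇔ (fun x < fun y)

  CommonFixedPoint : Fin n → Set
  CommonFixedPoint p = ∀ (Φ : Aut) → Aut.fun Φ p ≡ p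

  -- RankLt k z : rank(z) ≤ k - 1, i.e. z has some rank m < k.
  -- x has rank k iff x is minimal in P ∖ {z : rank z ≤ k-1}.
  RankLt : ℕ → Fin n → Set
  RankLt zero    z = ⊥
  RankLt (suc k) z = RankLt k z
                   ⊎ (¬ RankLt k z × ¬ (Σ (Fin n) λ y → y < z × ¬ RankLt k y))

  HasRank : ℕ → Fin n → Set
  HasRank k x = ¬ RankLt k x × ¬ (Σ (Fin n) λ y → y < x × ¬ RankLt k y)

  R : ℕ → Fin n → Set
  R = HasRank

  HasSize : (Fin n → Set) → ℕ → Set
  HasSize A m = Σ (List (Fin n)) λ xs →
                  Unique xs × (∀ x → (x ∈ xs) ⇔ A x) × length xs ≡ m

  AgreeOn : (Fin n → Set) → Aut → Aut → Set
  AgreeOn A Φ Ψ = ∀ x → A x → Aut.fun Φ x ≡ Aut.fun Ψ x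

  -- α(A) = m : there are exactly m distinct restrictions Φ|A, Φ ∈ Aut(P)
  NumRestrictions : (Fin n → Set) → ℕ → Set
  NumRestrictions A m =
    Σ (Fin m → Aut) λ Φs →
      (∀ i j → i ≢ j → ¬ AgreeOn A (Φs i) (Φs j))
    × (∀ Φ → ∃[ i ] AgreeOn A Φ (Φs i))

  OrderAutonomous : (Fin n → Set) → Set
  OrderAutonomous A =
    (∃[ a ] A a)
    × (∀ z → ¬ A z →
         (∀ a a' → A a → A a' → z < a → z < a')
       × (∀ a a' → A a → A a' → a < z → a' < z))

  RankGe : ℕ → Fin n → Set
  RankGe k x = ∃[ m ] HasRank m x × k ≤ m

  IsoInduced : (Fin n → Set) → (T : Set) → (T → T → Set) → Set
  IsoInduced A T _≺_ =
    Σ (T → Fin n) λ f →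
      Injective _≡_ _≡_ f
    × (∀ t → A (f t))
    × (∀ x → A x → ∃[ t ] f t ≡ x)
    × (∀ s t → (s ≺ t) ⇔ (f s < f t))

-- standard example S_k on Fin k ⊎ Fin k: inj₁ i = ℓ_i, inj₂ j = u_j, ℓ_i < u_j iff i ≠ j
data S-< (k : ℕ) : Fin k ⊎ Fin k → Fin k ⊎ Fin k → Set where
  ℓ<u : ∀ {i j} → i ≢ j → S-< k (Data.Sum.inj₁ i) (Data.Sum.inj₂ j)

data C2-< (k : ℕ) : Fin k ⊎ Fin k → Fin k ⊎ Fin k → Set where
  bot<top : ∀ {i j} → i ≡ j → C2-< k (Data.Sum.inj₁ i) (Data.Sum.inj₂ j)

{-# OPTIONS --safe #-}
module Submission where

-- Let ℓ₁, …, ℓₘ (m = w − 1) be the elements of R_j. As α(R_j) = m!, every permutation of R_j, in particular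
-- every transposition, is induced by an automorphism; and every antichain has at most m + 1 elements.
-- An element incomparable to all of R_j would, with its image under any automorphism, extend R_j to an
-- antichain of size m + 2, so it would be a common fixed point; hence everything of rank ≤ j lies below
-- some ℓᵢ, and non-autonomy of the ranks ≥ j + 1 yields x₀ ∈ R_{j+1} above some but not all ℓᵢ.
-- If x₀ were above two and not above two of the ℓᵢ, transposing would produce m + 2 elements of R_{j+1}
-- with distinct down-sets in R_j, again too many. So x₀ is above exactly one ℓᵢ, or above all but one,
-- and its images under transpositions give m elements of R_{j+1} realising all such down-sets; width and
-- the absence of common fixed points show that they exhaust R_{j+1}. This is S_m or mC₂, and every
-- automorphism acts on R_{j+1} as it acts on R_j, so α(R_{j+1}) = α(R_j).

open import Defs
open import Data.Nat using (ℕ; suc; _≤_; _∸_; _!)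
open import Data.Fin using (Fin)
open import Data.Product using (_×_; ∃-syntax)
open import Data.Sum using (_⊎_)
open import Relation.Nullary using (¬_)

open import Data.Nat using (zero; _<_; z≤n; s≤s)
import Data.Nat.Properties as ℕ
open import Data.Nat.GeneralisedArithmetic using (fold)
open import Data.Fin using (zero; suc; toℕ; punchOut; combine)
open import Data.Fin.Properties
  using (_≟_; any?; all?; suc-injective; punchOut-injective; combine-injective; injective⇒≤; pigeonhole; toℕ<n)
open import Data.Fin.Permutation.Components using (transpose)
open import Data.List using (List; _∷_; length; lookup; tabulate)
open import Data.List.Properties using (length-tabulate)
open import Data.List.Membership.Propositional.Properties using (∈-lookup)
open import Data.List.Relation.Unary.All using (_∷_)
import Data.List.Relation.Unary.All as All
import Data.List.Relation.Unary.All.Properties as Allₚ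
open import Data.List.Relation.Unary.AllPairs using (_∷_)
import Data.List.Relation.Unary.AllPairs.Properties as AllPairsₚ
open import Data.List.Relation.Unary.Any using (index)
open import Data.List.Relation.Unary.Any.Properties using (lookup-index)
open import Data.List.Relation.Unary.Unique.Propositional using (Unique)
open import Data.Product using (Σ; _,_; proj₁; proj₂)
open import Data.Sum using (inj₁; inj₂; [_,_])
open import Data.Empty using (⊥; ⊥-elim)
open import Function.Bundles using (_⇔_; mk⇔; Equivalence)
open import Function.Definitions using (Injective)
open import Function.Properties.Equivalence using () renaming (trans to ⇔-trans; sym to ⇔-sym)
open import Relation.Binary using (tri<; tri≈; tri>)
open import Relation.Binary.PropositionalEquality
  using (_≡_; _≢_; ≢-sym; refl; sym; cong; subst; subst₂; module ≡-Reasoning)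
  renaming (trans to ≡-trans)
open import Relation.Nullary using (Dec; yes; no; contradiction)
open import Relation.Nullary.Decidable using (_×-dec_; _⊎-dec_; _→-dec_; ¬?; map′)

open ≡-Reasoning

Injection : ℕ → Set
Injection m = Σ (Fin m → Fin m) (Injective _≡_ _≡_)

injection⇒onto : ∀ {m} (σ : Injection m) y → ∃[ x ] proj₁ σ x ≡ y
injection⇒onto (σ , σ-inj) y with any? (λ x → σ x ≟ y)
... | yes hit = hit
injection⇒onto {suc m} (σ , σ-inj) y | no miss =
  contradiction (injective⇒≤ σ′-injective) ℕ.1+n≰n
  where
  σx≢y : ∀ x → y ≢ σ x
  σx≢y x y≡σx = miss (x , sym y≡σx)
  σ′ : Fin (suc m) → Fin m
  σ′ x = punchOut (σx≢y x)
  σ′-injective : Injective _≡_ _≡_ σ′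
  σ′-injective {x} {x′} eq = σ-inj (punchOut-injective (σx≢y x) (σx≢y x′) eq)

tail : ∀ {m} → Injection (suc m) → Injection m
tail (σ , σ-inj) = σ′ , σ′-injective
  where
  σ0≢σsuc : ∀ i → σ zero ≢ σ (suc i)
  σ0≢σsuc i eq with σ-inj eq
  ... | ()
  σ′ : _ → _
  σ′ i = punchOut (σ0≢σsuc i)
  σ′-injective : Injective _≡_ _≡_ σ′
  σ′-injective {i} {k} eq = suc-injective (σ-inj (punchOut-injective (σ0≢σsuc i) (σ0≢σsuc k) eq))

-- The factorial number system: σ is coded by σ 0 and the code of σ with 0 and σ 0 removed.
code : ∀ {m} → Injection m → Fin (m !)
code {zero}  _ = zero
code {suc m} σ = combine (proj₁ σ zero) (code (tail σ))

code-injective : ∀ {m} (σ τ : Injection m) → code σ ≡ code τ → ∀ i → proj₁ σ i ≡ proj₁ τ i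
code-injective {suc m} σ τ eq i with combine-injective (proj₁ σ zero) _ (proj₁ τ zero) _ eq
code-injective {suc m} σ τ eq zero    | σ0≡τ0 , _ = σ0≡τ0
code-injective {suc m} σ τ eq (suc i) | σ0≡τ0 , tails≡ =
  punchOut-cong σ0≡τ0 (code-injective (tail σ) (tail τ) tails≡ i)
  where
  punchOut-cong : ∀ {n} {a a′ b b′ : Fin (suc n)} {p : a ≢ b} {q : a′ ≢ b′} →
                  a ≡ a′ → punchOut p ≡ punchOut q → b ≡ b′
  punchOut-cong {p = p} {q} refl = punchOut-injective p q

transpose-applyˡ : ∀ {m} (a b : Fin m) → transpose a b a ≡ b
transpose-applyˡ a b with a ≟ a
... | yes _ = refl
... | no a≢a = contradiction refl a≢a

transpose-applyʳ : ∀ {m} (a b : Fin m) → transpose a b b ≡ a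
transpose-applyʳ a b with b ≟ a
... | yes b≡a = b≡a
... | no _ with b ≟ b
...   | yes _ = refl
...   | no b≢b = contradiction refl b≢b

transpose-applyᵒ : ∀ {m} {a b e : Fin m} → e ≢ a → e ≢ b → transpose a b e ≡ e
transpose-applyᵒ {a = a} {b} {e} e≢a e≢b with e ≟ a
... | yes e≡a = contradiction e≡a e≢a
... | no _ with e ≟ b
...   | yes e≡b = contradiction e≡b e≢b
...   | no _ = refl

transpose-involutive : ∀ {m} (a b e : Fin m) → transpose a b (transpose a b e) ≡ e
transpose-involutive a b e with e ≟ a
... | yes refl = transpose-applyʳ e b
... | no e≢a with e ≟ b
...   | yes refl = transpose-applyˡ a e
...   | no e≢b = transpose-applyᵒ e≢a e≢b

transposition : ∀ {m} → Fin m → Fin m → Injection m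
transposition a b = transpose a b , λ {e} {e′} eq →
  ≡-trans (sym (transpose-involutive a b e)) (≡-trans (cong (transpose a b) eq) (transpose-involutive a b e′))

_⇔?_ : ∀ {A B : Set} → Dec A → Dec B → Dec (A ⇔ B)
A? ⇔? B? = map′ (λ (to , from) → mk⇔ to from) (λ A⇔B → Equivalence.to A⇔B , Equivalence.from A⇔B)
                ((A? →-dec B?) ×-dec (B? →-dec A?))

Incomparable : (P : FinPoset) → Fin (FinPoset.n P) → Fin (FinPoset.n P) → Set
Incomparable P x y = x ≢ y × ¬ FinPoset._<_ P x y × ¬ FinPoset._<_ P y x

module Rank (P : FinPoset) where
  open FinPoset P renaming (_<_ to _≺_)

  rankLt?        : ∀ k z → Dec (RankLt P k z)
  unrankedBelow? : ∀ k z → Dec (∃[ y ] y ≺ z × ¬ RankLt P k y)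
  rankLt? zero    z = no λ ()
  rankLt? (suc k) z with rankLt? k z | unrankedBelow? k z
  ... | yes lt  | _         = yes (inj₁ lt)
  ... | no ¬lt  | yes below = no λ { (inj₁ lt) → ¬lt lt ; (inj₂ (_ , ¬below)) → ¬below below }
  ... | no ¬lt  | no ¬below = yes (inj₂ (¬lt , ¬below))
  unrankedBelow? k z = any? (λ y → dec y z ×-dec ¬? (rankLt? k y))

  hasRank? : ∀ k z → Dec (HasRank P k z)
  hasRank? k z = ¬? (rankLt? k z) ×-dec ¬? (unrankedBelow? k z)

  ¬rankLt-suc⇒unrankedBelow : ∀ {k x} → ¬ RankLt P (suc k) x → ∃[ y ] y ≺ x × ¬ RankLt P k y
  ¬rankLt-suc⇒unrankedBelow {k} {x} ¬lt with unrankedBelow? k x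
  ... | yes below = below
  ... | no ¬below = contradiction (inj₂ ((λ lt → ¬lt (inj₁ lt)) , ¬below)) ¬lt

  rankLt-mono : ∀ {k k′ x} → k ≤ k′ → RankLt P k x → RankLt P k′ x
  rankLt-mono {k′ = zero}   z≤n  ()
  rankLt-mono {k′ = suc k′} k≤k′ lt with ℕ.m≤n⇒m<n∨m≡n k≤k′
  ... | inj₁ (s≤s k≤k′′) = inj₁ (rankLt-mono k≤k′′ lt)
  ... | inj₂ refl        = lt

  rankLt-suc⇒hasRank : ∀ {k x} → RankLt P (suc k) x → ¬ RankLt P k x → HasRank P k x
  rankLt-suc⇒hasRank (inj₁ lt)   ¬lt = contradiction lt ¬lt
  rankLt-suc⇒hasRank (inj₂ rank) _   = rank

  hasRank-unique : ∀ {k k′ x} → HasRank P k x → HasRank P k′ x → k ≡ k′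
  hasRank-unique {k} {k′} rk rk′ with ℕ.<-cmp k k′
  ... | tri< k<k′ _ _ = contradiction (rankLt-mono k<k′ (inj₂ rk)) (proj₁ rk′)
  ... | tri≈ _ k≡k′ _ = k≡k′
  ... | tri> _ _ k>k′ = contradiction (rankLt-mono k>k′ (inj₂ rk′)) (proj₁ rk)

  below⇒rankLt : ∀ {k x y} → y ≺ x → HasRank P k x → RankLt P k y
  below⇒rankLt {k} {y = y} y≺x rk with rankLt? k y
  ... | yes lt = lt
  ... | no ¬lt = contradiction (y , y≺x , ¬lt) (proj₂ rk)

  rank-strictMono : ∀ {k k′ x y} → y ≺ x → HasRank P k x → HasRank P k′ y → k′ < k
  rank-strictMono {k} {k′} y≺x rx ry with ℕ.<-cmp k′ k
  ... | tri< k′<k _ _ = k′<k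
  ... | tri≈ _ refl _ = contradiction (below⇒rankLt y≺x rx) (proj₁ ry)
  ... | tri> _ _ k′>k = contradiction (rankLt-mono (ℕ.<⇒≤ k′>k) (below⇒rankLt y≺x rx)) (proj₁ ry)

  sameRank⇒⊀ : ∀ {k x y} → HasRank P k x → HasRank P k y → ¬ x ≺ y
  sameRank⇒⊀ rx ry x≺y = ℕ.<-irrefl refl (rank-strictMono x≺y ry rx)

  sameRank⇒incomparable : ∀ {k x y} → HasRank P k x → HasRank P k y → x ≢ y → Incomparable P x y
  sameRank⇒incomparable rx ry x≢y = x≢y , sameRank⇒⊀ rx ry , sameRank⇒⊀ ry rx

  lower-cover : ∀ {k x} → HasRank P (suc k) x → ∃[ y ] y ≺ x × HasRank P k y
  lower-cover {k} (¬lt , ¬below) with ¬rankLt-suc⇒unrankedBelow ¬lt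
  ... | y , y≺x , ¬lt-y with rankLt? (suc k) y
  ...   | yes lt  = y , y≺x , rankLt-suc⇒hasRank lt ¬lt-y
  ...   | no ¬lt′ = contradiction (y , y≺x , ¬lt′) ¬below

  below-at-rank : ∀ {j k u} → j ≤ k → HasRank P k u → ∃[ x ] HasRank P j x × (x ≡ u ⊎ x ≺ u)
  below-at-rank {k = k} {u} j≤k ru with ℕ.m≤n⇒m<n∨m≡n j≤k
  ... | inj₂ refl = u , ru , inj₁ refl
  below-at-rank {k = suc k} j≤k ru | inj₁ (s≤s j≤k′) with lower-cover ru
  ... | y , y≺u , ry with below-at-rank j≤k′ ry
  ...   | x , rx , inj₁ refl = x , rx , inj₂ y≺u
  ...   | x , rx , inj₂ x≺y  = x , rx , inj₂ (trans x≺y y≺u)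

  DescendingFor : ℕ → (ℕ → Fin n) → Set
  DescendingFor k f = ∀ i → i < k → f (suc i) ≺ f i

  no-long-descent : ∀ f → ¬ DescendingFor n f
  no-long-descent f desc with pigeonhole (ℕ.n<1+n n) (λ (i : Fin (suc n)) → f (toℕ i))
  ... | i , k , i<k , fi≡fk = irrefl _ (subst (f (toℕ k) ≺_) fi≡fk (descent i<k (ℕ.≤-pred (toℕ<n k))))
    where
    descent : ∀ {a b} → a < b → b ≤ n → f b ≺ f a
    descent {a} {suc b} (s≤s a≤b) b<n with ℕ.m≤n⇒m<n∨m≡n a≤b
    ... | inj₂ refl = desc a b<n
    ... | inj₁ a<b  = trans (desc b b<n) (descent a<b (ℕ.<⇒≤ b<n))

  ¬rankLt⇒descent : ∀ k x → ¬ RankLt P k x → ∃[ f ] f 0 ≡ x × DescendingFor k f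
  ¬rankLt⇒descent zero    x _   = (λ _ → x) , refl , λ _ ()
  ¬rankLt⇒descent (suc k) x ¬lt with ¬rankLt-suc⇒unrankedBelow ¬lt
  ... | y , y≺x , ¬lt-y with ¬rankLt⇒descent k y ¬lt-y
  ...   | f , refl , desc = g , refl , desc′
    where
    g : ℕ → Fin n
    g zero    = x
    g (suc i) = f i
    desc′ : DescendingFor (suc k) g
    desc′ zero    _         = y≺x
    desc′ (suc i) (s≤s i<k) = desc i i<k

  rankLt⇒hasRank : ∀ k x → RankLt P k x → ∃[ k′ ] HasRank P k′ x
  rankLt⇒hasRank (suc k) x lt with rankLt? k x
  ... | yes lt′ = rankLt⇒hasRank k x lt′
  ... | no ¬lt′ = k , rankLt-suc⇒hasRank lt ¬lt′

  rank : ∀ x → ∃[ k ] HasRank P k x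
  rank x with rankLt? n x
  ... | yes lt = rankLt⇒hasRank n x lt
  ... | no ¬lt with ¬rankLt⇒descent n x ¬lt
  ...   | f , _ , desc = contradiction desc (no-long-descent f)

module Automorphisms (P : FinPoset) where
  open FinPoset P renaming (_<_ to _≺_)
  open Aut
  open Rank P

  _⁻¹ : Aut P → Aut P
  Φ ⁻¹ = record
    { fun   = inv Φ
    ; inv   = fun Φ
    ; invˡ  = invʳ Φ
    ; invʳ  = invˡ Φ
    ; order = λ x y → ⇔-sym (subst₂ (λ a b → inv Φ x ≺ inv Φ y ⇔ a ≺ b) (invʳ Φ x) (invʳ Φ y)
                                    (order Φ (inv Φ x) (inv Φ y)))
    }

  aut-mono : ∀ (Φ : Aut P) {x y} → x ≺ y → fun Φ x ≺ fun Φ y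
  aut-mono Φ {x} {y} = Equivalence.to (order Φ x y)

  aut-reflects : ∀ (Φ : Aut P) {x y} → fun Φ x ≺ fun Φ y → x ≺ y
  aut-reflects Φ {x} {y} = Equivalence.from (order Φ x y)

  aut-injective : ∀ (Φ : Aut P) → Injective _≡_ _≡_ (fun Φ)
  aut-injective Φ {x} {y} eq = ≡-trans (sym (invˡ Φ x)) (≡-trans (cong (inv Φ) eq) (invˡ Φ y))

  aut-preserves-rankLt : ∀ k (Φ : Aut P) {x} → RankLt P k x → RankLt P k (fun Φ x)
  aut-reflects-rankLt  : ∀ k (Φ : Aut P) {x} → RankLt P k (fun Φ x) → RankLt P k x
  aut-reflects-rankLt k Φ {x} lt = subst (RankLt P k) (invˡ Φ x) (aut-preserves-rankLt k (Φ ⁻¹) lt)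
  aut-preserves-rankLt (suc k) Φ (inj₁ lt) = inj₁ (aut-preserves-rankLt k Φ lt)
  aut-preserves-rankLt (suc k) Φ {x} (inj₂ (¬lt , ¬below)) =
    inj₂ ((λ lt → ¬lt (aut-reflects-rankLt k Φ lt)) , λ (y , y≺Φx , ¬lt-y) →
      ¬below (inv Φ y , aut-reflects Φ (subst (_≺ fun Φ x) (sym (invʳ Φ y)) y≺Φx) ,
              λ lt → ¬lt-y (subst (RankLt P k) (invʳ Φ y) (aut-preserves-rankLt k Φ lt))))

  aut-preserves-rank : ∀ {k x} (Φ : Aut P) → HasRank P k x → HasRank P k (fun Φ x)
  aut-preserves-rank {k} {x} Φ rx =
    rankLt-suc⇒hasRank (aut-preserves-rankLt (suc k) Φ (inj₂ rx)) (λ lt → proj₁ rx (aut-reflects-rankLt k Φ lt))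

  aut-preserves-incomparable : ∀ (Φ : Aut P) {x y} → Incomparable P x y → Incomparable P (fun Φ x) (fun Φ y)
  aut-preserves-incomparable Φ (x≢y , x⊀y , y⊀x) =
    (λ eq → x≢y (aut-injective Φ eq)) , (λ lt → x⊀y (aut-reflects Φ lt)) , (λ lt → y⊀x (aut-reflects Φ lt))

  -- The iterates of z would form an arbitrarily long descending chain.
  aut-no-descent : ∀ (Φ : Aut P) z → ¬ fun Φ z ≺ z
  aut-no-descent Φ z Φz≺z = no-long-descent (fold z (fun Φ)) (λ i _ → step i)
    where
    step : ∀ i → fun Φ (fold z (fun Φ) i) ≺ fold z (fun Φ) i
    step zero    = Φz≺z
    step (suc i) = aut-mono Φ (step i)

  aut-no-ascent : ∀ (Φ : Aut P) z → ¬ z ≺ fun Φ z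
  aut-no-ascent Φ z z≺Φz = aut-no-descent (Φ ⁻¹) z (subst (inv Φ z ≺_) (invˡ Φ z) (aut-mono (Φ ⁻¹) z≺Φz))

lookup-injective : ∀ {A : Set} {xs : List A} → Unique xs → Injective _≡_ _≡_ (lookup xs)
lookup-injective {xs = _ ∷ _} (_  ∷ _)    {zero}  {zero}  _  = refl
lookup-injective {xs = _ ∷ _} (x∉ ∷ _)    {zero}  {suc k} eq = contradiction eq (All.lookup x∉ (∈-lookup k))
lookup-injective {xs = _ ∷ _} (x∉ ∷ _)    {suc i} {zero}  eq = contradiction (sym eq) (All.lookup x∉ (∈-lookup i))
lookup-injective {xs = _ ∷ _} (_  ∷ uniq) {suc i} {suc k} eq = cong suc (lookup-injective uniq eq)

record Enumeration (P : FinPoset) (A : Fin (FinPoset.n P) → Set) (m : ℕ) : Set where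
  field
    elem           : Fin m → Fin (FinPoset.n P)
    elem-injective : Injective _≡_ _≡_ elem
    elem∈          : ∀ i → A (elem i)
    elem-onto      : ∀ x → A x → ∃[ i ] elem i ≡ x

hasSize⇒enumeration : ∀ {P A m} → HasSize P A m → Enumeration P A m
hasSize⇒enumeration (xs , uniq , ∈⇔A , refl) = record
  { elem           = lookup xs
  ; elem-injective = lookup-injective uniq
  ; elem∈          = λ i → Equivalence.to (∈⇔A _) (∈-lookup i)
  ; elem-onto      = λ x x∈A → let x∈xs = Equivalence.from (∈⇔A x) x∈A in index x∈xs , sym (lookup-index x∈xs)
  }

NumRestrictions-cong : ∀ {P A B k} → (∀ Φ Ψ → AgreeOn P A Φ Ψ ⇔ AgreeOn P B Φ Ψ) →
                       NumRestrictions P A k → NumRestrictions P B k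
NumRestrictions-cong A⇔B (Φs , distinct , cover) =
  Φs , (λ i k i≢k agree → distinct i k i≢k (Equivalence.from (A⇔B (Φs i) (Φs k)) agree)) ,
  λ Φ → let (i , agree) = cover Φ in i , Equivalence.to (A⇔B Φ (Φs i)) agree

module Induced (P : FinPoset) {A : Fin (FinPoset.n P) → Set}
               (A-invariant : ∀ (Φ : Aut P) {x} → A x → A (Aut.fun Φ x)) {m : ℕ} (E : Enumeration P A m) where
  open Enumeration E
  open Aut
  open Automorphisms P

  image : ∀ Φ i → ∃[ k ] elem k ≡ fun Φ (elem i)
  image Φ i = elem-onto _ (A-invariant Φ (elem∈ i))

  induced : Aut P → Injection m
  induced Φ = (λ i → proj₁ (image Φ i)) , λ {i} {k} eq →
    elem-injective (aut-injective Φ (≡-trans (sym (proj₂ (image Φ i))) (≡-trans (cong elem eq) (proj₂ (image Φ k)))))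

  Realizes : Aut P → Injection m → Set
  Realizes Φ σ = ∀ i → fun Φ (elem i) ≡ elem (proj₁ σ i)

  induced-realizes : ∀ Φ → Realizes Φ (induced Φ)
  induced-realizes Φ i = sym (proj₂ (image Φ i))

  agreeOn⇔induced≗ : ∀ Φ Ψ → AgreeOn P A Φ Ψ ⇔ (∀ i → proj₁ (induced Φ) i ≡ proj₁ (induced Ψ) i)
  agreeOn⇔induced≗ Φ Ψ = mk⇔
    (λ agree i → elem-injective (≡-trans (sym (induced-realizes Φ i))
                                 (≡-trans (agree _ (elem∈ i)) (induced-realizes Ψ i))))
    (λ same x x∈A → let (i , elem-i≡x) = elem-onto x x∈A in subst (λ y → fun Φ y ≡ fun Ψ y) elem-i≡x
       (≡-trans (induced-realizes Φ i) (≡-trans (cong elem (same i)) (sym (induced-realizes Ψ i)))))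

  -- m ! distinct restrictions have m ! distinct codes, so every code, i.e. every permutation, occurs.
  all-realized : NumRestrictions P A (m !) → ∀ σ → ∃[ Φ ] Realizes Φ σ
  all-realized (Φs , distinct , _) σ =
    let (k , codes≡) = injection⇒onto (codeOf , codeOf-injective) (code σ)
    in Φs k , λ i → ≡-trans (induced-realizes (Φs k) i) (cong elem (code-injective _ σ codes≡ i))
    where
    codeOf : Fin (m !) → Fin (m !)
    codeOf k = code (induced (Φs k))
    codeOf-injective : Injective _≡_ _≡_ codeOf
    codeOf-injective {k} {k′} eq with k ≟ k′
    ... | yes k≡k′ = k≡k′
    ... | no k≢k′  = contradiction (Equivalence.from (agreeOn⇔induced≗ (Φs k) (Φs k′))
                                      (code-injective _ _ eq)) (distinct k k′ k≢k′)

at-most-one-beyond : ∀ {P m} → (∀ xs → Antichain P xs → length xs ≤ suc m) →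
                     (g : Fin m → Fin (FinPoset.n P)) → (∀ {c c′} → c ≢ c′ → Incomparable P (g c) (g c′)) →
                     ∀ {y y′} → (∀ c → Incomparable P y (g c)) → (∀ c → Incomparable P y′ (g c)) →
                     ¬ FinPoset._<_ P y y′ → ¬ FinPoset._<_ P y′ y → y ≡ y′
at-most-one-beyond {P} {m} width g g-antichain {y} {y′} y-inc y′-inc y⊀y′ y′⊀y with y ≟ y′
... | yes y≡y′ = y≡y′
... | no y≢y′ = contradiction (subst (λ l → suc (suc l) ≤ suc m) (length-tabulate g) (width _ antichain)) ℕ.1+n≰n
  where
  antichain : Antichain P (y ∷ y′ ∷ tabulate g)
  antichain = ((y≢y′ , y⊀y′ , y′⊀y) ∷ Allₚ.tabulate⁺ y-inc)
            ∷ Allₚ.tabulate⁺ y′-inc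
            ∷ AllPairsₚ.tabulate⁺ g-antichain

other-index : ∀ {k} → 2 ≤ k → (c : Fin k) → ∃[ b ] c ≢ b
other-index (s≤s (s≤s _)) zero    = suc zero , λ ()
other-index (s≤s (s≤s _)) (suc c) = zero , λ ()

data Bipartite {m} (Q : Fin m → Fin m → Set) : Fin m ⊎ Fin m → Fin m ⊎ Fin m → Set where
  lower<upper : ∀ {i c} → Q i c → Bipartite Q (inj₁ i) (inj₂ c)

IsoInduced-cong : ∀ {P A T} {_≺_ _≺′_ : T → T → Set} → (∀ s t → s ≺ t ⇔ s ≺′ t) →
                  IsoInduced P A T _≺_ → IsoInduced P A T _≺′_
IsoInduced-cong ≺⇔≺′ (f , f-injective , f∈ , f-onto , f-order) =
  f , f-injective , f∈ , f-onto , λ s t → ⇔-trans (⇔-sym (≺⇔≺′ s t)) (f-order s t)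

Bipartite≢⇔S-< : ∀ {k} s t → Bipartite _≢_ s t ⇔ S-< k s t
Bipartite≢⇔S-< s t = mk⇔ (λ { (lower<upper i≢c) → ℓ<u i≢c }) (λ { (ℓ<u i≢c) → lower<upper i≢c })

Bipartite≡⇔C2-< : ∀ {k} s t → Bipartite _≡_ s t ⇔ C2-< k s t
Bipartite≡⇔C2-< s t = mk⇔ (λ { (lower<upper i≡c) → bot<top i≡c }) (λ { (bot<top i≡c) → lower<upper i≡c })

module Levels
  (P : FinPoset) (j m : ℕ) (E : Enumeration P (R P j) m)
  (width : ∀ xs → Antichain P xs → length xs ≤ suc m)
  (no-fixed-point : ∀ p → ¬ CommonFixedPoint P p)
  (restrictions : NumRestrictions P (R P j) (m !))
  (2≤m : 2 ≤ m)
  where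
  open FinPoset P renaming (_<_ to _≺_)
  open Aut
  open Rank P
  open Automorphisms P
  open Enumeration E renaming (elem to ℓ; elem-injective to ℓ-injective; elem∈ to ℓ-rank; elem-onto to ℓ-onto)
  open Induced P (λ Φ → aut-preserves-rank Φ) E

  ℓ-antichain : ∀ {i k} → i ≢ k → Incomparable P (ℓ i) (ℓ k)
  ℓ-antichain i≢k = sameRank⇒incomparable (ℓ-rank _) (ℓ-rank _) (λ eq → i≢k (ℓ-injective eq))

  realizes-below : ∀ {Φ σ} → Realizes Φ σ → ∀ {i y} → ℓ i ≺ y ⇔ ℓ (proj₁ σ i) ≺ fun Φ y
  realizes-below {Φ} realizes {i} {y} = mk⇔
    (λ ℓi≺y → subst (_≺ fun Φ y) (realizes i) (aut-mono Φ ℓi≺y))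
    (λ ℓσi≺Φy → aut-reflects Φ (subst (_≺ fun Φ y) (sym (realizes i)) ℓσi≺Φy))

  aut-onto-level : ∀ Φ c → ∃[ i ] fun Φ (ℓ i) ≡ ℓ c
  aut-onto-level Φ c = let (i , σi≡c) = injection⇒onto (induced Φ) c in
    i , ≡-trans (induced-realizes Φ i) (cong ℓ σi≡c)

  IncomparableToLevel : Fin n → Set
  IncomparableToLevel z = ∀ i → Incomparable P z (ℓ i)

  aut-preserves-incomparableToLevel : ∀ Φ {z} → IncomparableToLevel z → IncomparableToLevel (fun Φ z)
  aut-preserves-incomparableToLevel Φ z-inc c = let (i , Φℓi≡ℓc) = aut-onto-level Φ c in
    subst (Incomparable P _) Φℓi≡ℓc (aut-preserves-incomparable Φ (z-inc i))

  -- An automorphism moves nothing strictly up or down, so z and Φ z would extend the level to an antichain.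
  incomparableToLevel⇒fixed : ∀ {z} → IncomparableToLevel z → CommonFixedPoint P z
  incomparableToLevel⇒fixed {z} z-inc Φ = sym (at-most-one-beyond {P} width ℓ ℓ-antichain z-inc
    (aut-preserves-incomparableToLevel Φ z-inc) (aut-no-ascent Φ z) (aut-no-descent Φ z))

  comparable-to-level : ∀ z → ∃[ i ] (z ≡ ℓ i ⊎ z ≺ ℓ i ⊎ ℓ i ≺ z)
  comparable-to-level z with any? (λ i → (z ≟ ℓ i) ⊎-dec dec z (ℓ i) ⊎-dec dec (ℓ i) z)
  ... | yes comparable = comparable
  ... | no ¬comparable = contradiction (incomparableToLevel⇒fixed z-inc) (no-fixed-point z)
    where
    z-inc : IncomparableToLevel z
    z-inc i = (λ eq → ¬comparable (i , inj₁ eq)) , (λ lt → ¬comparable (i , inj₂ (inj₁ lt))) ,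
              (λ lt → ¬comparable (i , inj₂ (inj₂ lt)))

  Upper : Fin n → Set
  Upper = RankGe P (suc j)

  above-level⇒autonomous : (∃[ x ] Upper x) → (∀ x → HasRank P (suc j) x → ∀ i → ℓ i ≺ x) →
                           OrderAutonomous P Upper
  above-level⇒autonomous nonempty above = nonempty , λ z z∉U → below-all z z∉U , above-none z z∉U
    where
    level⊀outside : ∀ {z} → ¬ Upper z → ∀ {i} → ¬ ℓ i ≺ z
    level⊀outside {z} z∉U {i} ℓi≺z = let (k , rz) = rank z in z∉U (k , rz , rank-strictMono ℓi≺z rz (ℓ-rank i))
    above-none : ∀ z → ¬ Upper z → ∀ a a′ → Upper a → Upper a′ → a ≺ z → a′ ≺ z
    above-none z z∉U a _ (k , rk , j<k) _ a≺z = let (kz , rz) = rank z in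
      contradiction (kz , rz , ℕ.≤-trans j<k (ℕ.<⇒≤ (rank-strictMono a≺z rz rk))) z∉U
    below-all : ∀ z → ¬ Upper z → ∀ a a′ → Upper a → Upper a′ → z ≺ a → z ≺ a′
    below-all z z∉U _ a′ _ (k , rk , j<k) _ with below-at-rank j<k rk | comparable-to-level z
    ... | x , rx , x≼a′ | i , z≼ℓi = below-a′ x≼a′
      where
      z≺x : z ≺ x
      z≺x = [ (λ z≡ℓi → subst (_≺ x) (sym z≡ℓi) (above x rx i))
            , [ (λ z≺ℓi → trans z≺ℓi (above x rx i))
              , (λ ℓi≺z → contradiction ℓi≺z (level⊀outside z∉U)) ] ] z≼ℓi
      below-a′ : x ≡ a′ ⊎ x ≺ a′ → z ≺ a′
      below-a′ (inj₁ refl) = z≺x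
      below-a′ (inj₂ x≺a′) = trans z≺x x≺a′

  partly-above-level : (∃[ x ] Upper x) → ¬ OrderAutonomous P Upper →
                       ∃[ x ] HasRank P (suc j) x × ∃[ b ] ¬ ℓ b ≺ x
  partly-above-level nonempty ¬autonomous with any? (λ x → hasRank? (suc j) x ×-dec any? (λ b → ¬? (dec (ℓ b) x)))
  ... | yes partly = partly
  ... | no ¬partly = contradiction (above-level⇒autonomous nonempty above) ¬autonomous
    where
    above : ∀ x → HasRank P (suc j) x → ∀ i → ℓ i ≺ x
    above x rx i with dec (ℓ i) x
    ... | yes ℓi≺x = ℓi≺x
    ... | no ℓi⊀x  = contradiction (x , rx , i , ℓi⊀x) ¬partly

  some-below : ∀ {x} → HasRank P (suc j) x → ∃[ a ] ℓ a ≺ x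
  some-below rx = let (y , y≺x , ry) = lower-cover rx ; (a , ℓa≡y) = ℓ-onto y ry in
    a , subst (_≺ _) (sym ℓa≡y) y≺x

  τ : Fin m → Fin m → Aut P
  τ a b = proj₁ (all-realized restrictions (transposition a b))

  τ-realizes : ∀ a b → Realizes (τ a b) (transposition a b)
  τ-realizes a b = proj₂ (all-realized restrictions (transposition a b))

  τ-below : ∀ a b {e y} → ℓ e ≺ fun (τ a b) y ⇔ ℓ (transpose a b e) ≺ y
  τ-below a b {e} {y} =
    subst (λ i → ℓ i ≺ fun (τ a b) y ⇔ ℓ (transpose a b e) ≺ y) (transpose-involutive a b e)
          (⇔-sym (realizes-below {τ a b} {transposition a b} (τ-realizes a b)))

  τ-below⁺ : ∀ a b e {q y} → transpose a b e ≡ q → ℓ q ≺ y → ℓ e ≺ fun (τ a b) y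
  τ-below⁺ a b e te≡q ℓq≺y = Equivalence.from (τ-below a b) (subst (λ i → ℓ i ≺ _) (sym te≡q) ℓq≺y)

  τ-below⁻ : ∀ a b e {q y} → transpose a b e ≡ q → ¬ ℓ q ≺ y → ¬ ℓ e ≺ fun (τ a b) y
  τ-below⁻ a b e te≡q ℓq⊀y ℓe≺τy =
    ℓq⊀y (subst (λ i → ℓ i ≺ _) te≡q (Equivalence.to (τ-below a b) ℓe≺τy))

  separated : ∀ {e y y′} → ℓ e ≺ y → ¬ ℓ e ≺ y′ → y ≢ y′
  separated ℓe≺y ℓe⊀y′ refl = ℓe⊀y′ ℓe≺y

  separated′ : ∀ {e y y′} → ¬ ℓ e ≺ y → ℓ e ≺ y′ → y ≢ y′
  separated′ ℓe⊀y ℓe≺y′ = ≢-sym (separated ℓe≺y′ ℓe⊀y)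

  index-separated : ∀ {p q y} → ℓ p ≺ y → ¬ ℓ q ≺ y → p ≢ q
  index-separated ℓp≺y ℓq⊀y refl = ℓq⊀y ℓp≺y

  data Position (y : Fin n) (b : Fin m) (c : Fin m) : Set where
    at    : c ≡ b → Position y b c
    below : ℓ c ≺ y → Position y b c
    other : c ≢ b → ¬ ℓ c ≺ y → Position y b c

  position : ∀ y b c → Position y b c
  position y b c with c ≟ b
  ... | yes c≡b = at c≡b
  ... | no c≢b with dec (ℓ c) y
  ...   | yes ℓc≺y = below ℓc≺y
  ...   | no ℓc⊀y  = other c≢b ℓc⊀y

  -- With D = {i | ℓ i ≺ y} the down-set of y, the element v c has down-set D, D - c + b₁ or D - a₁ + c
  -- according to the position of c, z₁ has D - a₂ + b₂ and z₂ has D - a₁ - a₂ + b₁ + b₂: m + 2 distinct sets.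
  module TwoInTwoOut {y : Fin n} {a₁ a₂ b₁ b₂ : Fin m}
    (ry : HasRank P (suc j) y) (a₁≢a₂ : a₁ ≢ a₂) (b₁≢b₂ : b₁ ≢ b₂)
    (ℓa₁≺y : ℓ a₁ ≺ y) (ℓa₂≺y : ℓ a₂ ≺ y) (ℓb₁⊀y : ¬ ℓ b₁ ≺ y) (ℓb₂⊀y : ¬ ℓ b₂ ≺ y) where

    a₁≢b₁ : a₁ ≢ b₁
    a₁≢b₁ = index-separated ℓa₁≺y ℓb₁⊀y
    a₁≢b₂ : a₁ ≢ b₂
    a₁≢b₂ = index-separated ℓa₁≺y ℓb₂⊀y
    a₂≢b₁ : a₂ ≢ b₁
    a₂≢b₁ = index-separated ℓa₂≺y ℓb₁⊀y

    vAt : ∀ c → Position y b₁ c → Fin n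
    vAt c (at _)      = y
    vAt c (below _)   = fun (τ c b₁) y
    vAt c (other _ _) = fun (τ a₁ c) y

    v : Fin m → Fin n
    v c = vAt c (position y b₁ c)

    vAt-rank : ∀ c p → HasRank P (suc j) (vAt c p)
    vAt-rank c (at _)      = ry
    vAt-rank c (below _)   = aut-preserves-rank (τ c b₁) ry
    vAt-rank c (other _ _) = aut-preserves-rank (τ a₁ c) ry

    v-rank : ∀ c → HasRank P (suc j) (v c)
    v-rank c = vAt-rank c (position y b₁ c)

    vAt-distinct : ∀ c c′ p p′ → c ≢ c′ → vAt c p ≢ vAt c′ p′
    vAt-distinct c c′ (at c≡b₁) (at c′≡b₁) c≢c′ = contradiction (≡-trans c≡b₁ (sym c′≡b₁)) c≢c′
    vAt-distinct c c′ (at refl) (below ℓc′≺y) _ =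
      separated′ ℓb₁⊀y (τ-below⁺ c′ b₁ b₁ (transpose-applyʳ c′ b₁) ℓc′≺y)
    vAt-distinct c c′ (at refl) (other _ ℓc′⊀y) _ =
      separated ℓa₁≺y (τ-below⁻ a₁ c′ a₁ (transpose-applyˡ a₁ c′) ℓc′⊀y)
    vAt-distinct c c′ (below ℓc≺y) (at refl) _ =
      separated (τ-below⁺ c b₁ b₁ (transpose-applyʳ c b₁) ℓc≺y) ℓb₁⊀y
    vAt-distinct c c′ (below ℓc≺y) (below ℓc′≺y) c≢c′ =
      separated (τ-below⁺ c b₁ c′ (transpose-applyᵒ (≢-sym c≢c′) (index-separated ℓc′≺y ℓb₁⊀y))
                          ℓc′≺y)
                (τ-below⁻ c′ b₁ c′ (transpose-applyˡ c′ b₁) ℓb₁⊀y)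
    vAt-distinct c c′ (below ℓc≺y) (other c′≢b₁ _) _ =
      separated (τ-below⁺ c b₁ b₁ (transpose-applyʳ c b₁) ℓc≺y)
                (τ-below⁻ a₁ c′ b₁ (transpose-applyᵒ (≢-sym a₁≢b₁) (≢-sym c′≢b₁)) ℓb₁⊀y)
    vAt-distinct c c′ (other _ ℓc⊀y) (at refl) _ =
      separated′ (τ-below⁻ a₁ c a₁ (transpose-applyˡ a₁ c) ℓc⊀y) ℓa₁≺y
    vAt-distinct c c′ (other c≢b₁ _) (below ℓc′≺y) _ =
      separated′ (τ-below⁻ a₁ c b₁ (transpose-applyᵒ (≢-sym a₁≢b₁) (≢-sym c≢b₁)) ℓb₁⊀y)
                 (τ-below⁺ c′ b₁ b₁ (transpose-applyʳ c′ b₁) ℓc′≺y)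
    vAt-distinct c c′ (other _ ℓc⊀y) (other _ _) c≢c′ =
      separated (τ-below⁺ a₁ c c (transpose-applyʳ a₁ c) ℓa₁≺y)
                (τ-below⁻ a₁ c′ c (transpose-applyᵒ (≢-sym (index-separated ℓa₁≺y ℓc⊀y)) c≢c′) ℓc⊀y)

    z₁ : Fin n
    z₁ = fun (τ a₂ b₂) y

    ℓa₁≺z₁ : ℓ a₁ ≺ z₁
    ℓa₁≺z₁ = τ-below⁺ a₂ b₂ a₁ (transpose-applyᵒ a₁≢a₂ a₁≢b₂) ℓa₁≺y

    ℓb₁⊀z₁ : ¬ ℓ b₁ ≺ z₁
    ℓb₁⊀z₁ = τ-below⁻ a₂ b₂ b₁ (transpose-applyᵒ (≢-sym a₂≢b₁) b₁≢b₂) ℓb₁⊀y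

    z₁-distinct : ∀ c p → z₁ ≢ vAt c p
    z₁-distinct c (at refl)        = separated′ (τ-below⁻ a₂ b₂ a₂ (transpose-applyˡ a₂ b₂) ℓb₂⊀y) ℓa₂≺y
    z₁-distinct c (below ℓc≺y)   = separated′ ℓb₁⊀z₁ (τ-below⁺ c b₁ b₁ (transpose-applyʳ c b₁) ℓc≺y)
    z₁-distinct c (other _ ℓc⊀y) = separated ℓa₁≺z₁ (τ-below⁻ a₁ c a₁ (transpose-applyˡ a₁ c) ℓc⊀y)

    z₂ : Fin n
    z₂ = fun (τ a₁ b₁) z₁

    ℓb₁≺z₂ : ℓ b₁ ≺ z₂
    ℓb₁≺z₂ = τ-below⁺ a₁ b₁ b₁ (transpose-applyʳ a₁ b₁) ℓa₁≺z₁

    ℓb₂≺z₂ : ℓ b₂ ≺ z₂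
    ℓb₂≺z₂ = τ-below⁺ a₁ b₁ b₂ (transpose-applyᵒ (≢-sym a₁≢b₂) (≢-sym b₁≢b₂))
                      (τ-below⁺ a₂ b₂ b₂ (transpose-applyʳ a₂ b₂) ℓa₂≺y)

    z₂-distinct : ∀ c p → z₂ ≢ vAt c p
    z₂-distinct c (at refl)         = separated ℓb₁≺z₂ ℓb₁⊀y
    z₂-distinct c (below ℓc≺y)  =
      separated ℓb₂≺z₂ (τ-below⁻ c b₁ b₂ (transpose-applyᵒ (≢-sym (index-separated ℓc≺y ℓb₂⊀y)) (≢-sym b₁≢b₂))
                                 ℓb₂⊀y)
    z₂-distinct c (other c≢b₁ _) =
      separated ℓb₁≺z₂ (τ-below⁻ a₁ c b₁ (transpose-applyᵒ (≢-sym a₁≢b₁) (≢-sym c≢b₁)) ℓb₁⊀y)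

    z₁-rank : HasRank P (suc j) z₁
    z₁-rank = aut-preserves-rank (τ a₂ b₂) ry

    z₂-rank : HasRank P (suc j) z₂
    z₂-rank = aut-preserves-rank (τ a₁ b₁) z₁-rank

    impossible : ⊥
    impossible = separated′ ℓb₁⊀z₁ ℓb₁≺z₂ (at-most-one-beyond {P} width v
      (λ {c} {c′} c≢c′ → sameRank⇒incomparable (v-rank c) (v-rank c′)
                           (vAt-distinct c c′ (position y b₁ c) (position y b₁ c′) c≢c′))
      (λ c → sameRank⇒incomparable z₁-rank (v-rank c) (z₁-distinct c (position y b₁ c)))
      (λ c → sameRank⇒incomparable z₂-rank (v-rank c) (z₂-distinct c (position y b₁ c)))
      (sameRank⇒⊀ z₁-rank z₂-rank) (sameRank⇒⊀ z₂-rank z₁-rank))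

  no-two-in-two-out : ∀ {y a₁ a₂ b₁ b₂} → HasRank P (suc j) y → a₁ ≢ a₂ → b₁ ≢ b₂ →
                      ℓ a₁ ≺ y → ℓ a₂ ≺ y → ¬ ℓ b₁ ≺ y → ¬ ℓ b₂ ≺ y → ⊥
  no-two-in-two-out ry a₁≢a₂ b₁≢b₂ ℓa₁≺y ℓa₂≺y ℓb₁⊀y ℓb₂⊀y =
    TwoInTwoOut.impossible ry a₁≢a₂ b₁≢b₂ ℓa₁≺y ℓa₂≺y ℓb₁⊀y ℓb₂⊀y

  -- The down-set of y in the level is {i | Q i c}; Q = _≡_ leads to mC₂ and Q = _≢_ to S_m.
  Shape : (Fin m → Fin m → Set) → Fin n → Fin m → Set
  Shape Q y c = ∀ i → ℓ i ≺ y ⇔ Q i c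

  extremal-element : (∃[ x ] Upper x) → ¬ OrderAutonomous P Upper →
                     ∃[ x₀ ] HasRank P (suc j) x₀ × ∃[ c₀ ] (Shape _≡_ x₀ c₀ ⊎ Shape _≢_ x₀ c₀)
  extremal-element nonempty ¬autonomous
    with partly-above-level nonempty ¬autonomous
  ... | x₀ , rx₀ , b₀ , ℓb₀⊀x₀
    with some-below rx₀
  ... | a₀ , ℓa₀≺x₀
    with any? (λ a → ¬? (a ≟ a₀) ×-dec dec (ℓ a) x₀) | any? (λ b → ¬? (b ≟ b₀) ×-dec ¬? (dec (ℓ b) x₀))
  ... | yes (a , a≢a₀ , ℓa≺x₀) | yes (b , b≢b₀ , ℓb⊀x₀) =
    ⊥-elim (no-two-in-two-out rx₀ a≢a₀ b≢b₀ ℓa≺x₀ ℓa₀≺x₀ ℓb⊀x₀ ℓb₀⊀x₀)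
  ... | no ¬other-below | _ = x₀ , rx₀ , a₀ , inj₁ λ i → mk⇔ (only-a₀ i) (λ { refl → ℓa₀≺x₀ })
    where
    only-a₀ : ∀ i → ℓ i ≺ x₀ → i ≡ a₀
    only-a₀ i ℓi≺x₀ with i ≟ a₀
    ... | yes i≡a₀ = i≡a₀
    ... | no i≢a₀  = contradiction (i , i≢a₀ , ℓi≺x₀) ¬other-below
  ... | yes _ | no ¬other-above =
    x₀ , rx₀ , b₀ , inj₂ λ i → mk⇔ (λ ℓi≺x₀ → index-separated ℓi≺x₀ ℓb₀⊀x₀) (all-but-b₀ i)
    where
    all-but-b₀ : ∀ i → i ≢ b₀ → ℓ i ≺ x₀
    all-but-b₀ i i≢b₀ with dec (ℓ i) x₀
    ... | yes ℓi≺x₀ = ℓi≺x₀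
    ... | no ℓi⊀x₀  = contradiction (i , i≢b₀ , ℓi⊀x₀) ¬other-above

  module Orbit (Q : Fin m → Fin m → Set) (Q? : ∀ i c → Dec (Q i c))
    (Q-invariant : ∀ (σ : Injection m) {i c} → Q i c ⇔ Q (proj₁ σ i) (proj₁ σ c))
    (Q-determines : ∀ {c c′} → (∀ i → Q i c ⇔ Q i c′) → c ≡ c′)
    {x₀ : Fin n} {c₀ : Fin m} (rx₀ : HasRank P (suc j) x₀) (x₀-shape : Shape Q x₀ c₀) where

    shape? : ∀ y c → Dec (Shape Q y c)
    shape? y c = all? (λ i → dec (ℓ i) y ⇔? Q? i c)

    shape-transport : ∀ Φ σ {y c} → Realizes Φ σ → Shape Q y c → Shape Q (fun Φ y) (proj₁ σ c)
    shape-transport Φ σ realizes shape i with injection⇒onto σ i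
    ... | k , refl = ⇔-trans (⇔-sym (realizes-below {Φ} {σ} realizes)) (⇔-trans (shape k) (Q-invariant σ))

    aut-shape : ∀ Φ {y c} → Shape Q y c → Shape Q (fun Φ y) (proj₁ (induced Φ) c)
    aut-shape Φ = shape-transport Φ (induced Φ) (induced-realizes Φ)

    τ-shape : ∀ a b {y} → Shape Q y a → Shape Q (fun (τ a b) y) b
    τ-shape a b shape = subst (Shape Q _) (transpose-applyˡ a b)
                              (shape-transport (τ a b) (transposition a b) (τ-realizes a b) shape)

    shape-unique : ∀ {y c c′} → Shape Q y c → Shape Q y c′ → c ≡ c′
    shape-unique shape shape′ = Q-determines λ i → ⇔-trans (⇔-sym (shape i)) (shape′ i)

    shapes-separate : ∀ {y y′ c c′} → Shape Q y c → Shape Q y′ c′ → c ≢ c′ → y ≢ y′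
    shapes-separate shape shape′ c≢c′ refl = c≢c′ (shape-unique shape shape′)

    u : Fin m → Fin n
    u c = fun (τ c₀ c) x₀

    u-rank : ∀ c → HasRank P (suc j) (u c)
    u-rank c = aut-preserves-rank (τ c₀ c) rx₀

    u-shape : ∀ c → Shape Q (u c) c
    u-shape c = τ-shape c₀ c x₀-shape

    u-injective : Injective _≡_ _≡_ u
    u-injective {c} {c′} uc≡uc′ with c ≟ c′
    ... | yes c≡c′ = c≡c′
    ... | no c≢c′  = contradiction uc≡uc′ (shapes-separate (u-shape c) (u-shape c′) c≢c′)

    Outside : Fin n → Set
    Outside y = ∀ c → y ≢ u c

    shape-outside : ∀ {y c} → Shape Q y c → y ≢ u c → Outside y
    shape-outside {c = c} shape y≢uc c′ with c′ ≟ c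
    ... | yes refl = y≢uc
    ... | no c′≢c  = shapes-separate shape (u-shape c′) (≢-sym c′≢c)

    one-outside : ∀ {y y′} → HasRank P (suc j) y → HasRank P (suc j) y′ → Outside y → Outside y′ → y ≡ y′
    one-outside ry ry′ y-out y′-out = at-most-one-beyond {P} width u
      (λ c≢c′ → sameRank⇒incomparable (u-rank _) (u-rank _) (λ eq → c≢c′ (u-injective eq)))
      (λ c → sameRank⇒incomparable ry (u-rank c) (y-out c))
      (λ c → sameRank⇒incomparable ry′ (u-rank c) (y′-out c))
      (sameRank⇒⊀ ry ry′) (sameRank⇒⊀ ry′ ry)

    -- The shapeless elements of rank j + 1 are permuted by every automorphism and at most one exists.
    shaped : ∀ {y} → HasRank P (suc j) y → ∃[ c ] Shape Q y c
    shaped {y} ry with any? (shape? y)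
    ... | yes has-shape = has-shape
    ... | no shapeless = contradiction fixed (no-fixed-point y)
      where
      shapeless-outside : ∀ {y} → ¬ (∃[ c ] Shape Q y c) → Outside y
      shapeless-outside ¬shape c refl = ¬shape (c , u-shape c)
      aut-shapeless : ∀ Φ → ¬ (∃[ c ] Shape Q (fun Φ y) c)
      aut-shapeless Φ (c , shape) =
        shapeless (proj₁ (induced (Φ ⁻¹)) c , subst (λ z → Shape Q z _) (invˡ Φ y) (aut-shape (Φ ⁻¹) shape))
      fixed : CommonFixedPoint P y
      fixed Φ = sym (one-outside ry (aut-preserves-rank Φ ry) (shapeless-outside shapeless)
                                    (shapeless-outside (aut-shapeless Φ)))

    -- An element of shape c other than u c is moved by τ c b to shape b, as is u c, and the two images differ.
    stray-everywhere : ∀ {y c} → HasRank P (suc j) y → Shape Q y c → y ≢ u c →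
                       ∀ b → ∃[ y′ ] HasRank P (suc j) y′ × Shape Q y′ b × y′ ≢ u b
    stray-everywhere {y} {c} ry shape y≢uc b = pick (fun T y ≟ u b)
      where
      T = τ c b
      pick : Dec (fun T y ≡ u b) → ∃[ y′ ] HasRank P (suc j) y′ × Shape Q y′ b × y′ ≢ u b
      pick (no Ty≢ub)  = fun T y , aut-preserves-rank T ry , τ-shape c b shape , Ty≢ub
      pick (yes Ty≡ub) = fun T (u c) , aut-preserves-rank T (u-rank c) , τ-shape c b (u-shape c) ,
                         λ Tuc≡ub → y≢uc (aut-injective T (≡-trans Ty≡ub (sym Tuc≡ub)))

    u-onto : ∀ {y} → HasRank P (suc j) y → ∃[ c ] u c ≡ y
    u-onto {y} ry with shaped ry
    ... | c , shape with y ≟ u c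
    ...   | yes y≡uc = c , sym y≡uc
    ...   | no y≢uc with other-index 2≤m c
    ...     | b , c≢b with stray-everywhere ry shape y≢uc b
    ...       | y′ , ry′ , shape′ , y′≢ub =
      contradiction (one-outside ry ry′ (shape-outside shape y≢uc) (shape-outside shape′ y′≢ub))
                    (shapes-separate shape shape′ c≢b)

    shape-determines : ∀ {y c} → HasRank P (suc j) y → Shape Q y c → y ≡ u c
    shape-determines ry shape with u-onto ry
    ... | c′ , refl = cong u (shape-unique (u-shape c′) shape)

    u-equivariant : ∀ Φ c → fun Φ (u c) ≡ u (proj₁ (induced Φ) c)
    u-equivariant Φ c = shape-determines (aut-preserves-rank Φ (u-rank c)) (aut-shape Φ (u-shape c))

    agreeOn-levels : ∀ Φ Ψ → AgreeOn P (R P j) Φ Ψ ⇔ AgreeOn P (R P (suc j)) Φ Ψ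
    agreeOn-levels Φ Ψ = mk⇔
      (λ agree y ry → let (c , uc≡y) = u-onto ry in subst (λ z → fun Φ z ≡ fun Ψ z) uc≡y (begin
         fun Φ (u c)                  ≡⟨ u-equivariant Φ c ⟩
         u (proj₁ (induced Φ) c)      ≡⟨ cong u (Equivalence.to (agreeOn⇔induced≗ Φ Ψ) agree c) ⟩
         u (proj₁ (induced Ψ) c)      ≡⟨ u-equivariant Ψ c ⟨
         fun Ψ (u c)                  ∎))
      (λ agree → Equivalence.from (agreeOn⇔induced≗ Φ Ψ) λ c → u-injective (begin
         u (proj₁ (induced Φ) c)      ≡⟨ u-equivariant Φ c ⟨
         fun Φ (u c)                  ≡⟨ agree (u c) (u-rank c) ⟩
         fun Ψ (u c)                  ≡⟨ u-equivariant Ψ c ⟩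
         u (proj₁ (induced Ψ) c)      ∎))

    lower-upper-iso : IsoInduced P (λ x → R P j x ⊎ R P (suc j) x) (Fin m ⊎ Fin m) (Bipartite Q)
    lower-upper-iso = f , f-injective , f∈ , f-onto , f-order
      where
      f : Fin m ⊎ Fin m → Fin n
      f = [ ℓ , u ]
      ℓ≢u : ∀ i c → ℓ i ≢ u c
      ℓ≢u i c ℓi≡uc = ℕ.1+n≢n (sym (hasRank-unique (ℓ-rank i) (subst (HasRank P (suc j)) (sym ℓi≡uc) (u-rank c))))
      f-injective : Injective _≡_ _≡_ f
      f-injective {inj₁ i} {inj₁ k}  eq = cong inj₁ (ℓ-injective eq)
      f-injective {inj₁ i} {inj₂ c}  eq = contradiction eq (ℓ≢u i c)
      f-injective {inj₂ c} {inj₁ i}  eq = contradiction (sym eq) (ℓ≢u i c)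
      f-injective {inj₂ c} {inj₂ c′} eq = cong inj₂ (u-injective eq)
      f∈ : ∀ t → R P j (f t) ⊎ R P (suc j) (f t)
      f∈ (inj₁ i) = inj₁ (ℓ-rank i)
      f∈ (inj₂ c) = inj₂ (u-rank c)
      f-onto : ∀ x → R P j x ⊎ R P (suc j) x → ∃[ t ] f t ≡ x
      f-onto x (inj₁ rx) = let (i , ℓi≡x) = ℓ-onto x rx in inj₁ i , ℓi≡x
      f-onto x (inj₂ rx) = let (c , uc≡x) = u-onto rx in inj₂ c , uc≡x
      f-order : ∀ s t → Bipartite Q s t ⇔ f s ≺ f t
      f-order (inj₁ i) (inj₂ c) = mk⇔ (λ { (lower<upper q) → Equivalence.from (u-shape c i) q })
                                      (λ ℓi≺uc → lower<upper (Equivalence.to (u-shape c i) ℓi≺uc))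
      f-order (inj₁ i) (inj₁ k) = mk⇔ (λ ()) (λ ℓi≺ℓk → contradiction ℓi≺ℓk (sameRank⇒⊀ (ℓ-rank i) (ℓ-rank k)))
      f-order (inj₂ c) (inj₂ k) = mk⇔ (λ ()) (λ uc≺uk → contradiction uc≺uk (sameRank⇒⊀ (u-rank c) (u-rank k)))
      f-order (inj₂ c) (inj₁ i) = mk⇔ (λ ()) (λ uc≺ℓi →
        contradiction (rank-strictMono uc≺ℓi (ℓ-rank i) (u-rank c)) (ℕ.<-asym (ℕ.n<1+n j)))

  conclusion : (∃[ x ] Upper x) → ¬ OrderAutonomous P Upper →
               (IsoInduced P (λ x → R P j x ⊎ R P (suc j) x) (Fin m ⊎ Fin m) (S-< m)
                 ⊎ IsoInduced P (λ x → R P j x ⊎ R P (suc j) x) (Fin m ⊎ Fin m) (C2-< m))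
               × NumRestrictions P (R P (suc j)) (m !)
  conclusion nonempty ¬autonomous with extremal-element nonempty ¬autonomous
  ... | x₀ , rx₀ , c₀ , inj₁ x₀-above-one =
    inj₂ (IsoInduced-cong {P} Bipartite≡⇔C2-< lower-upper-iso) , NumRestrictions-cong agreeOn-levels restrictions
    where
    open Orbit _≡_ _≟_ (λ σ → mk⇔ (cong (proj₁ σ)) (proj₂ σ)) (λ same → Equivalence.to (same _) refl)
               rx₀ x₀-above-one
  ... | x₀ , rx₀ , c₀ , inj₂ x₀-above-all-but-one =
    inj₁ (IsoInduced-cong {P} Bipartite≢⇔S-< lower-upper-iso) , NumRestrictions-cong agreeOn-levels restrictions
    where
    ≢-determines : ∀ {c c′ : Fin m} → (∀ i → i ≢ c ⇔ i ≢ c′) → c ≡ c′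
    ≢-determines {c} {c′} same with c ≟ c′
    ... | yes c≡c′ = c≡c′
    ... | no c≢c′  = contradiction refl (Equivalence.from (same c) c≢c′)
    open Orbit _≢_ (λ i c → ¬? (i ≟ c))
      (λ σ → mk⇔ (λ i≢c σi≡σc → i≢c (proj₂ σ σi≡σc))
                 (λ σi≢σc i≡c → σi≢σc (cong (proj₁ σ) i≡c)))
      ≢-determines rx₀ x₀-above-all-but-one

lemma2p4 : (P : FinPoset) → (w j : ℕ) →
    Width P w → 3 ≤ w →
    (∀ p → ¬ CommonFixedPoint P p) →
    HasSize P (R P j) (w ∸ 1) →
    NumRestrictions P (R P j) ((w ∸ 1) !) →
    (∃[ x ] RankGe P (suc j) x) →
    ¬ OrderAutonomous P (RankGe P (suc j)) →
    (IsoInduced P (λ x → R P j x ⊎ R P (suc j) x)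
        (Fin (w ∸ 1) ⊎ Fin (w ∸ 1)) (S-< (w ∸ 1))
      ⊎ IsoInduced P (λ x → R P j x ⊎ R P (suc j) x)
        (Fin (w ∸ 1) ⊎ Fin (w ∸ 1)) (C2-< (w ∸ 1)))
    × NumRestrictions P (R P (suc j)) ((w ∸ 1) !)
lemma2p4 P (suc m) j (_ , width) (s≤s 2≤m) no-fixed-point level-size restrictions =
  Levels.conclusion P j m (hasSize⇒enumeration level-size) width no-fixed-point restrictions 2≤m
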